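{- For every atom $X$, the set $[\![X]\!]$ is a closed set of the E-phase space: for all terms $t,s$, term-variables $x$, atoms $Z,Y$, and $T_1,\dots,T_k$ each a closed term or an atom, (i) if $t[x:=s]T_1\cdots T_k\in[\![X]\!]$ and $(\lambda x.t)sT_1\cdots T_k$ is closed, then $(\lambda x.t)sT_1\cdots T_k\in[\![X]\!]$; (ii) if $t[Z:=Y]T_1\cdots T_k\in[\![X]\!]$ and $(\Lambda Z.t)YT_1\cdots T_k$ is closed, then $(\Lambda Z.t)YT_1\cdots T_k\in[\![X]\!]$. (Monotonicity holds trivially since the monoid has one element.)
   Context: $\mathbf{IL_{at}}$: formulas $A::=X\mid A\to B\mid\forall X.A$; terms $t::=x\mid c^A\mid\lambda x.t\mid ts\mid\Lambda X.t\mid tX$ (a term-constant $c^A$ for every formula $A$; in $tX$, $X$ is an atom), up to $\alpha$-equivalence, capture-avoiding substitution. A term is closed if it has no free term-variables. Typing rules: $\Gamma,x:A\vdash x:A$; $\Gamma\vdash c^A:A$; $\to$-introduction $\Gamma,x:A\vdash t:B\Rightarrow\Gamma\vdash\lambda x.t:A\to B$; $\to$-elimination $\Gamma\vdash t:A\to B,\ \Gamma\vdash s:A\Rightarrow\Gamma\vdash ts:B$; $\forall$-introduction $\Gamma\vdash t:A\Rightarrow\Gamma\vdash\Lambda X.t:\forall X.A$ provided $X$ is not free in the formulas of $\Gamma$; $\forall$-elimination $\Gamma\vdash t:\forall X.A\Rightarrow\Gamma\vdash tY:A[X:=Y]$ for an atom $Y$. $\beta$-reduction $\to_\beta$ is the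 compatible closure of $(\lambda x.t)s\to_\beta t[x:=s]$ and $(\Lambda X.t)Y\to_\beta t[X:=Y]$; $\twoheadrightarrow$ is its reflexive-transitive closure; a term is normal if it contains no redex. E-phase space: monoid $\{\emptyset\}$, domain the pairs $(\emptyset\rhd t)$ with $t$ closed, identified with closed terms. For a formula $A$, $[\![A]\!]=\{t \text{ closed}\mid t\twoheadrightarrow s\text{ for some normal }s\text{ with }\vdash s:A\text{ derivable}\}$. -}

module Defs where

open import Data.Nat using (ℕ; zero; suc; _<_)
open import Data.List using (List; []; _∷_; map)
open import Data.List.Relation.Unary.All using (All)
open import Data.Product using (Σ; _×_; _,_)
open import Data.Unit using (⊤)
open import Relation.Nullary using (¬_)

-- Syntax of IL_at, with de Bruijn indices for both atoms (bound by ∀ in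
-- formulas and by Λ in terms) and term-variables (bound by λ).  Indices not bound by
-- an enclosing binder denote free atoms / free term-variables.

infixr 30 _⇒_

data Form : Set where
  at  : ℕ → Form
  _⇒_ : Form → Form → Form
  ∀'  : Form → Form            -- ∀X.A  (X = index 0 in the body)

data Term : Set where
  var  : ℕ → Term
  con  : Form → Term           -- constant c^A
  lam  : Term → Term
  app  : Term → Term → Term
  Lam  : Term → Term
  tapp : Term → ℕ → Term

ext : (ℕ → ℕ) → ℕ → ℕ
ext ρ zero    = zero
ext ρ (suc n) = suc (ρ n)

-- the renaming  0 ↦ Y, n+1 ↦ n   (substitution [Z:=Y] for the bound atom Z)
_•ᵃ : ℕ → ℕ → ℕ
(Y •ᵃ) zero    = Y
(Y •ᵃ) (suc n) = n

renF : (ℕ → ℕ) → Form → Form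
renF ρ (at X)  = at (ρ X)
renF ρ (A ⇒ B) = renF ρ A ⇒ renF ρ B
renF ρ (∀' A)  = ∀' (renF (ext ρ) A)

renTA : (ℕ → ℕ) → Term → Term
renTA ρ (var x)    = var x
renTA ρ (con A)    = con (renF ρ A)
renTA ρ (lam t)    = lam (renTA ρ t)
renTA ρ (app t s)  = app (renTA ρ t) (renTA ρ s)
renTA ρ (Lam t)    = Lam (renTA (ext ρ) t)
renTA ρ (tapp t X) = tapp (renTA ρ t) (ρ X)

renTV : (ℕ → ℕ) → Term → Term
renTV ρ (var x)    = var (ρ x)
renTV ρ (con A)    = con A
renTV ρ (lam t)    = lam (renTV (ext ρ) t)
renTV ρ (app t s)  = app (renTV ρ t) (renTV ρ s)
renTV ρ (Lam t)    = Lam (renTV ρ t)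
renTV ρ (tapp t X) = tapp (renTV ρ t) X

extsλ : (ℕ → Term) → ℕ → Term
extsλ σ zero    = var zero
extsλ σ (suc n) = renTV suc (σ n)

extsΛ : (ℕ → Term) → ℕ → Term
extsΛ σ n = renTA suc (σ n)

sub : (ℕ → Term) → Term → Term
sub σ (var x)    = σ x
sub σ (con A)    = con A
sub σ (lam t)    = lam (sub (extsλ σ) t)
sub σ (app t s)  = app (sub σ t) (sub σ s)
sub σ (Lam t)    = Lam (sub (extsΛ σ) t)
sub σ (tapp t X) = tapp (sub σ t) X

_•ᵗ : Term → ℕ → Term
(s •ᵗ) zero    = s
(s •ᵗ) (suc n) = var n

-- t[x:=s]  where x is the bound variable (index 0) of λx.t
_[_]ᵗ : Term → Term → Term
t [ s ]ᵗ = sub (s •ᵗ) t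

-- t[Z:=Y]  where Z is the bound atom (index 0) of ΛZ.t
_[_]ᵃ : Term → ℕ → Term
t [ Y ]ᵃ = renTA (Y •ᵃ) t

-- A[X:=Y] where X is the bound atom (index 0) of ∀X.A
_[_]ᶠ : Form → ℕ → Form
A [ Y ]ᶠ = renF (Y •ᵃ) A

infix 4 _⟶_ _↠_

data _⟶_ : Term → Term → Set where
  β-λ   : ∀ {t s} → app (lam t) s ⟶ t [ s ]ᵗ
  β-Λ   : ∀ {t Y} → tapp (Lam t) Y ⟶ t [ Y ]ᵃ
  ξ-lam : ∀ {t t'} → t ⟶ t' → lam t ⟶ lam t'
  ξ-appˡ : ∀ {t t' s} → t ⟶ t' → app t s ⟶ app t' s
  ξ-appʳ : ∀ {t s s'} → s ⟶ s' → app t s ⟶ app t s'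
  ξ-Lam : ∀ {t t'} → t ⟶ t' → Lam t ⟶ Lam t'
  ξ-tapp : ∀ {t t' X} → t ⟶ t' → tapp t X ⟶ tapp t' X

data _↠_ : Term → Term → Set where
  ↠-refl : ∀ {t} → t ↠ t
  ↠-step : ∀ {t t' t''} → t ⟶ t' → t' ↠ t'' → t ↠ t''

data ContainsRedex : Term → Set where
  here-λ : ∀ {t s} → ContainsRedex (app (lam t) s)
  here-Λ : ∀ {t Y} → ContainsRedex (tapp (Lam t) Y)
  in-lam : ∀ {t} → ContainsRedex t → ContainsRedex (lam t)
  in-appˡ : ∀ {t s} → ContainsRedex t → ContainsRedex (app t s)
  in-appʳ : ∀ {t s} → ContainsRedex s → ContainsRedex (app t s)
  in-Lam : ∀ {t} → ContainsRedex t → ContainsRedex (Lam t)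
  in-tapp : ∀ {t X} → ContainsRedex t → ContainsRedex (tapp t X)

Normal : Term → Set
Normal t = ¬ ContainsRedex t

-- Closed terms: no free term-variables (free atoms are allowed)

data TVScoped : ℕ → Term → Set where
  s-var  : ∀ {n x} → x < n → TVScoped n (var x)
  s-con  : ∀ {n A} → TVScoped n (con A)
  s-lam  : ∀ {n t} → TVScoped (suc n) t → TVScoped n (lam t)
  s-app  : ∀ {n t s} → TVScoped n t → TVScoped n s → TVScoped n (app t s)
  s-Lam  : ∀ {n t} → TVScoped n t → TVScoped n (Lam t)
  s-tapp : ∀ {n t X} → TVScoped n t → TVScoped n (tapp t X)

Closed : Term → Set
Closed t = TVScoped 0 t

-- Typing (contexts: list of formulas, index 0 = most recent variable)

Ctx : Set
Ctx = List Form

infix 4 _∋_∶_ _⊢_∶_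

data _∋_∶_ : Ctx → ℕ → Form → Set where
  here  : ∀ {Γ A} → (A ∷ Γ) ∋ zero ∶ A
  there : ∀ {Γ A B x} → Γ ∋ x ∶ A → (B ∷ Γ) ∋ suc x ∶ A

data _⊢_∶_ : Ctx → Term → Form → Set where
  ⊢var  : ∀ {Γ x A} → Γ ∋ x ∶ A → Γ ⊢ var x ∶ A
  ⊢con  : ∀ {Γ A} → Γ ⊢ con A ∶ A
  ⊢lam  : ∀ {Γ t A B} → (A ∷ Γ) ⊢ t ∶ B → Γ ⊢ lam t ∶ A ⇒ B
  ⊢app  : ∀ {Γ t s A B} → Γ ⊢ t ∶ A ⇒ B → Γ ⊢ s ∶ A → Γ ⊢ app t s ∶ B
  -- ∀-introduction: the eigen-atom (index 0) is fresh for Γ because Γ is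
  -- shifted past it (de Bruijn rendering of the side condition)
  ⊢Lam  : ∀ {Γ t A} → map (renF suc) Γ ⊢ t ∶ A → Γ ⊢ Lam t ∶ ∀' A
  ⊢tapp : ∀ {Γ t A} {Y : ℕ} → Γ ⊢ t ∶ ∀' A → Γ ⊢ tapp t Y ∶ A [ Y ]ᶠ

⟦_⟧ : Form → Term → Set
⟦ A ⟧ t = Closed t × Σ Term (λ s → (t ↠ s) × Normal s × ([] ⊢ s ∶ A))

data Arg : Set where
  tm : Term → Arg
  ty : ℕ → Arg

ArgOK : Arg → Set
ArgOK (tm u) = Closed u
ArgOK (ty _) = ⊤

_·⃗_ : Term → List Arg → Term
t ·⃗ []          = t
t ·⃗ (tm u ∷ Ts) = app t u ·⃗ Ts
t ·⃗ (ty Y ∷ Ts) = tapp t Y ·⃗ Ts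

-- closed set of the E-phase space (monotonicity is trivial: one-element monoid)
ClosedSet : (Term → Set) → Set
ClosedSet P =
  (∀ (t s : Term) (Ts : List Arg) → All ArgOK Ts →
     P ((t [ s ]ᵗ) ·⃗ Ts) → Closed (app (lam t) s ·⃗ Ts) →
     P (app (lam t) s ·⃗ Ts))
  × (∀ (t : Term) (Y : ℕ) (Ts : List Arg) → All ArgOK Ts →
     P ((t [ Y ]ᵃ) ·⃗ Ts) → Closed (tapp (Lam t) Y ·⃗ Ts) →
     P (tapp (Lam t) Y ·⃗ Ts))

{-# OPTIONS --safe #-}
module Submission where

open import Data.Nat using (ℕ)
open import Data.List using (List; []; _∷_)
open import Data.Product using (_,_)
open import Defs

·⃗-cong-⟶ : ∀ {t t'} (Ts : List Arg) → t ⟶ t' → t ·⃗ Ts ⟶ t' ·⃗ Ts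
·⃗-cong-⟶ []          r = r
·⃗-cong-⟶ (tm u ∷ Ts) r = ·⃗-cong-⟶ Ts (ξ-appˡ r)
·⃗-cong-⟶ (ty Y ∷ Ts) r = ·⃗-cong-⟶ Ts (ξ-tapp r)

⟦⟧-expand : ∀ A {t t'} → t ⟶ t' → ⟦ A ⟧ t' → Closed t → ⟦ A ⟧ t
⟦⟧-expand A r (_ , s , t'↠s , normal , ⊢s) closed = closed , s , ↠-step r t'↠s , normal , ⊢s

⟦⟧-closedSet : ∀ A → ClosedSet ⟦ A ⟧
⟦⟧-closedSet A =
    (λ _ _ Ts _ → ⟦⟧-expand A (·⃗-cong-⟶ Ts β-λ))
  , (λ _ _ Ts _ → ⟦⟧-expand A (·⃗-cong-⟶ Ts β-Λ))

mainTheorem3 : (X : ℕ) → ClosedSet ⟦ at X ⟧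
mainTheorem3 X = ⟦⟧-closedSet (at X)
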